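{- Let $a_1,\dots,a_{w-1}$ and $b_1,\dots,b_w$ be positive integers such that the partial tableau with top row $b_1,\dots,b_w$ and bottom row $a_1,\dots,a_{w-1}$ (with $a_j$ directly below $b_j$ for $j\le w-1$, and nothing below $b_w$) has no inversions among the $b$'s. If the $a$'s are rearranged in any way and then the $b$'s are rearranged in the unique way guaranteeing no inversions among the $b$'s, then $b_w$ is still in the last position of the top row, and the total number of descents among the top-row entries (columns $j\le w-1$ whose top entry is strictly greater than the entry below) is unchanged.
   Context: An inversion among the top-row entries is a pair $u,v$ in the top row with $u$ to the left of $v$ such that, with $b$ the bottom-row entry directly below $u$, $u\le b<v$, or $b<v<u$, or $v<u\le b$. -}

module Defs where

open import Data.Nat using (ℕ; suc; _≤_; _<_; _<?_)
open import Data.Fin using (Fin; inject₁; fromℕ) renaming (_<_ to _<ᶠ_)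
open import Data.Fin.Permutation using (Permutation′; _⟨$⟩ʳ_)
open import Data.List using (List; length; filter)
open import Data.List.Base using (allFin)
open import Data.Product using (_×_)
open import Data.Sum using (_⊎_)
open import Relation.Nullary using (¬_)

-- A partial tableau of width w = suc n:
--   top row    b : Fin (suc n) → ℕ   (b_1 … b_w)
--   bottom row a : Fin n → ℕ         (a_1 … a_{w-1}),
-- with a i directly below b (inject₁ i); nothing below the last top entry.

Inversion : {n : ℕ} → (Fin n → ℕ) → (Fin (suc n) → ℕ) → Fin n → Fin (suc n) → Set
Inversion a b i j =
  inject₁ i <ᶠ j ×
  ((u ≤ x × x < v) ⊎ ((x < v × v < u) ⊎ (v < u × u ≤ x)))
  where
    u = b (inject₁ i)
    v = b j
    x = a i

NoInversions : {n : ℕ} → (Fin n → ℕ) → (Fin (suc n) → ℕ) → Set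
NoInversions a b = ∀ i j → ¬ Inversion a b i j

descents : {n : ℕ} → (Fin n → ℕ) → (Fin (suc n) → ℕ) → ℕ
descents {n} a b = length (filter (λ i → a i <? b (inject₁ i)) (allFin n))

lastCol : (n : ℕ) → Fin (suc n)
lastCol n = fromℕ n

Positive : {m : ℕ} → (Fin m → ℕ) → Set
Positive f = ∀ i → 0 < f i

rearr : {m : ℕ} → Permutation′ m → (Fin m → ℕ) → (Fin m → ℕ)
rearr σ f i = f (σ ⟨$⟩ʳ i)

-- Write u ≼[ x ] v when u comes no later than v in the cyclic order of ℕ that starts just
-- above x: first the numbers > x increasingly, then the numbers ≤ x increasingly. A top entry
-- u with x below it forms an inversion with a top entry v to its right exactly when v comes
-- strictly before u in this order. So a tableau has no inversions iff every top entry is the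
-- ≼-least, for the order based at the entry below it, of itself and the top entries to its
-- right; the top row is therefore determined greedily by the bottom row and the multiset of top
-- entries. Invariance of the last top entry and of the descent count is then checked on
-- adjacent transpositions of the bottom row, which generate all rearrangements: the two top
-- entries above the transposed pair either stay put or are exchanged, and in the first case
-- the number of descents among them is unchanged because [ x < u ] = [ x < v ] + [ v < u ]
-- whenever u ≼[ x ] v.

module Submission where

open import Defs
open import Algebra.Properties.CommutativeMonoid.Sum as CommutativeMonoidSum using ()
open import Data.Bool using (true; false; if_then_else_)
open import Data.Empty using (⊥-elim)
open import Data.Fin using (Fin; zero; suc; fromℕ; inject₁)
open import Data.Fin.Permutation using (Permutation′; id; lift₀; transpose; _∘ₚ_)
open import Data.List using (List; []; _∷_; length; last; tabulate; filter)
open import Data.List.Relation.Unary.All as All using (All; []; _∷_)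
open import Data.List.Relation.Unary.All.Properties using (tabulate⁺)
open import Data.List.Relation.Unary.Any using (here; there)
open import Data.List.Relation.Binary.Permutation.Propositional as ↭
  using (_↭_; prep; swap; ↭-sym; module PermutationReasoning)
open import Data.List.Relation.Binary.Permutation.Propositional.Properties
  using (∈-resp-↭; All-resp-↭; drop-∷; ↭-singleton-inv; ↭-length; ++-commutativeMonoid)
open import Data.Maybe using (just)
open import Data.Maybe.Properties using (just-injective)
open import Data.Nat using (ℕ; zero; suc; pred; _+_; _≤_; _<_; _<?_; _≤?_; _<ᵇ_; _≟_; z<s; s<s)
open import Data.Nat.Properties
  using (≤-refl; ≤-trans; ≤-antisym; ≤-total; <-≤-trans; ≤-<-trans; <⇒≱; ≤⇒≯; ≮⇒≥; ≰⇒>;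
         +-comm; +-assoc)
open import Data.Nat.Tactic.RingSolver using (solve-∀)
open import Data.Product using (Σ; ∃; ∃₂; _×_; _,_; proj₁; proj₂)
open import Data.Sum using (_⊎_; inj₁; inj₂)
open import Function using (_∘_)
open import Relation.Binary.PropositionalEquality
  using (_≡_; _≢_; refl; sym; trans; cong; cong₂; module ≡-Reasoning)
open import Relation.Nullary using (¬_; yes; no; does)
open import Relation.Nullary.Decidable using (dec-true; dec-false)

infix 4 _≼[_]_

data _≼[_]_ (u x v : ℕ) : Set where
  high : x < u → x < v → u ≤ v → u ≼[ x ] v
  wrap : x < u → v ≤ x → u ≼[ x ] v
  low  : u ≤ x → v ≤ x → u ≤ v → u ≼[ x ] v

module _ {x u v : ℕ} where

  ≼-high⁻¹ : u ≼[ x ] v → x < v → x < u × u ≤ v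
  ≼-high⁻¹ (high x<u _ u≤v) _   = x<u , u≤v
  ≼-high⁻¹ (wrap _ v≤x)     x<v = ⊥-elim (<⇒≱ x<v v≤x)
  ≼-high⁻¹ (low _ v≤x _)    x<v = ⊥-elim (<⇒≱ x<v v≤x)

  ≼-low⁻¹ : u ≼[ x ] v → u ≤ x → v ≤ x × u ≤ v
  ≼-low⁻¹ (high x<u _ _)  u≤x = ⊥-elim (<⇒≱ x<u u≤x)
  ≼-low⁻¹ (wrap x<u _)    u≤x = ⊥-elim (<⇒≱ x<u u≤x)
  ≼-low⁻¹ (low _ v≤x u≤v) _   = v≤x , u≤v

  ≼-wrap⁻¹ : u ≼[ x ] v → v < u → x < u × v ≤ x
  ≼-wrap⁻¹ (high _ _ u≤v) v<u = ⊥-elim (<⇒≱ v<u u≤v)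
  ≼-wrap⁻¹ (wrap x<u v≤x) _   = x<u , v≤x
  ≼-wrap⁻¹ (low _ _ u≤v)  v<u = ⊥-elim (<⇒≱ v<u u≤v)

≼-refl : ∀ x u → u ≼[ x ] u
≼-refl x u with x <? u
... | yes x<u = high x<u x<u ≤-refl
... | no  x≮u = low (≮⇒≥ x≮u) (≮⇒≥ x≮u) ≤-refl

≼-total : ∀ x u v → u ≼[ x ] v ⊎ v ≼[ x ] u
≼-total x u v with x <? u | x <? v | ≤-total u v
... | yes x<u | yes x<v | inj₁ u≤v = inj₁ (high x<u x<v u≤v)
... | yes x<u | yes x<v | inj₂ v≤u = inj₂ (high x<v x<u v≤u)
... | yes x<u | no  x≮v | _        = inj₁ (wrap x<u (≮⇒≥ x≮v))
... | no  x≮u | yes x<v | _        = inj₂ (wrap x<v (≮⇒≥ x≮u))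
... | no  x≮u | no  x≮v | inj₁ u≤v = inj₁ (low (≮⇒≥ x≮u) (≮⇒≥ x≮v) u≤v)
... | no  x≮u | no  x≮v | inj₂ v≤u = inj₂ (low (≮⇒≥ x≮v) (≮⇒≥ x≮u) v≤u)

≼-trans : ∀ {x u v w} → u ≼[ x ] v → v ≼[ x ] w → u ≼[ x ] w
≼-trans {x} {u} {v} {w} u≼v v≼w with x <? w | x <? u
... | yes x<w | _ =
  let x<v , v≤w = ≼-high⁻¹ v≼w x<w
      x<u , u≤v = ≼-high⁻¹ u≼v x<v
  in high x<u x<w (≤-trans u≤v v≤w)
... | no x≮w | yes x<u = wrap x<u (≮⇒≥ x≮w)
... | no x≮w | no x≮u =
  let v≤x , u≤v = ≼-low⁻¹ u≼v (≮⇒≥ x≮u)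
      w≤x , v≤w = ≼-low⁻¹ v≼w v≤x
  in low (≮⇒≥ x≮u) w≤x (≤-trans u≤v v≤w)

≼-antisym : ∀ {x u v} → u ≼[ x ] v → v ≼[ x ] u → u ≡ v
≼-antisym (high x<u _ u≤v) v≼u = ≤-antisym u≤v (proj₂ (≼-high⁻¹ v≼u x<u))
≼-antisym (wrap x<u v≤x)   v≼u = ⊥-elim (<⇒≱ x<u (proj₁ (≼-low⁻¹ v≼u v≤x)))
≼-antisym (low _ v≤x u≤v)  v≼u = ≤-antisym u≤v (proj₂ (≼-low⁻¹ v≼u v≤x))

-- Makes the second top entry survive a transposition of the first two bottom entries.
≼-rebase : ∀ {x y u w₁ w₂} → u ≼[ x ] w₁ → u ≼[ y ] w₂ → w₁ ≼[ x ] w₂ → w₁ ≼[ y ] w₂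
≼-rebase {x} {y} {u} {w₁} {w₂} u≼ˣw₁ u≼ʸw₂ w₁≼ˣw₂ with y <? w₁ | y <? w₂
... | yes y<w₁ | no y≮w₂  = wrap y<w₁ (≮⇒≥ y≮w₂)
... | yes y<w₁ | yes y<w₂ = high y<w₁ y<w₂ w₁≤w₂
  where
  w₁≤w₂ : w₁ ≤ w₂
  w₁≤w₂ with x <? w₂
  ... | yes x<w₂ = proj₂ (≼-high⁻¹ w₁≼ˣw₂ x<w₂)
  ... | no  x≮w₂ =
    let u≤x = ≤-trans (proj₂ (≼-high⁻¹ u≼ʸw₂ y<w₂)) (≮⇒≥ x≮w₂)
    in proj₂ (≼-low⁻¹ w₁≼ˣw₂ (proj₁ (≼-low⁻¹ u≼ˣw₁ u≤x)))
... | no y≮w₁ | no y≮w₂ = low (≮⇒≥ y≮w₁) (≮⇒≥ y≮w₂) w₁≤w₂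
  where
  w₁≤w₂ : w₁ ≤ w₂
  w₁≤w₂ with x <? w₁
  ... | no  x≮w₁ = proj₂ (≼-low⁻¹ w₁≼ˣw₂ (≮⇒≥ x≮w₁))
  ... | yes x<w₁ =
    let x<u , u≤w₁ = ≼-high⁻¹ u≼ˣw₁ x<w₁
        _ , u≤w₂ = ≼-low⁻¹ u≼ʸw₂ (≤-trans u≤w₁ (≮⇒≥ y≮w₁))
    in proj₂ (≼-high⁻¹ w₁≼ˣw₂ (<-≤-trans x<u u≤w₂))
... | no y≮w₁ | yes y<w₂ =
  let y<u , u≤w₂ = ≼-high⁻¹ u≼ʸw₂ y<w₂
      x<u , w₁≤x = ≼-wrap⁻¹ u≼ˣw₁ (≤-<-trans (≮⇒≥ y≮w₁) y<u)
      w₂≤x , _ = ≼-low⁻¹ w₁≼ˣw₂ w₁≤x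
  in ⊥-elim (<⇒≱ x<u (≤-trans u≤w₂ w₂≤x))

Inverted : ℕ → ℕ → ℕ → Set
Inverted x u v = (u ≤ x × x < v) ⊎ ((x < v × v < u) ⊎ (v < u × u ≤ x))

≼⇒¬Inverted : ∀ {x u v} → u ≼[ x ] v → ¬ Inverted x u v
≼⇒¬Inverted (high x<u _ _) (inj₁ (u≤x , _))        = <⇒≱ x<u u≤x
≼⇒¬Inverted (high _ _ u≤v) (inj₂ (inj₁ (_ , v<u))) = <⇒≱ v<u u≤v
≼⇒¬Inverted (high x<u _ _) (inj₂ (inj₂ (_ , u≤x))) = <⇒≱ x<u u≤x
≼⇒¬Inverted (wrap x<u _)   (inj₁ (u≤x , _))        = <⇒≱ x<u u≤x
≼⇒¬Inverted (wrap _ v≤x)   (inj₂ (inj₁ (x<v , _))) = <⇒≱ x<v v≤x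
≼⇒¬Inverted (wrap x<u _)   (inj₂ (inj₂ (_ , u≤x))) = <⇒≱ x<u u≤x
≼⇒¬Inverted (low _ v≤x _)  (inj₁ (_ , x<v))        = <⇒≱ x<v v≤x
≼⇒¬Inverted (low _ v≤x _)  (inj₂ (inj₁ (x<v , _))) = <⇒≱ x<v v≤x
≼⇒¬Inverted (low _ _ u≤v)  (inj₂ (inj₂ (v<u , _))) = <⇒≱ v<u u≤v

¬Inverted⇒≼ : ∀ x u v → ¬ Inverted x u v → u ≼[ x ] v
¬Inverted⇒≼ x u v ¬inv with x <? u | v ≤? x | u ≤? v
... | yes x<u | yes v≤x | _       = wrap x<u v≤x
... | yes x<u | no  v≰x | yes u≤v = high x<u (≰⇒> v≰x) u≤v
... | yes x<u | no  v≰x | no  u≰v = ⊥-elim (¬inv (inj₂ (inj₁ (≰⇒> v≰x , ≰⇒> u≰v))))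
... | no  x≮u | no  v≰x | _       = ⊥-elim (¬inv (inj₁ (≮⇒≥ x≮u , ≰⇒> v≰x)))
... | no  x≮u | yes v≤x | yes u≤v = low (≮⇒≥ x≮u) v≤x u≤v
... | no  x≮u | yes v≤x | no  u≰v = ⊥-elim (¬inv (inj₂ (inj₂ (≰⇒> u≰v , ≮⇒≥ x≮u))))

[_<_] : ℕ → ℕ → ℕ
[ m < n ] = if does (m <? n) then 1 else 0

[<]-true : ∀ {m n} → m < n → [ m < n ] ≡ 1
[<]-true {m} {n} m<n rewrite dec-true (m <? n) m<n = refl

[<]-false : ∀ {m n} → n ≤ m → [ m < n ] ≡ 0
[<]-false {m} {n} n≤m rewrite dec-false (m <? n) (≤⇒≯ n≤m) = refl

≼-indicator : ∀ {x u v} → u ≼[ x ] v → [ x < u ] ≡ [ x < v ] + [ v < u ]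
≼-indicator (high x<u x<v u≤v)
  rewrite [<]-true x<u | [<]-true x<v | [<]-false u≤v = refl
≼-indicator (wrap x<u v≤x)
  rewrite [<]-true x<u | [<]-false v≤x | [<]-true (≤-<-trans v≤x x<u) = refl
≼-indicator (low u≤x v≤x u≤v)
  rewrite [<]-false u≤x | [<]-false v≤x | [<]-false u≤v = refl

descent-exchange : ∀ {x y u v} → u ≼[ x ] v → u ≼[ y ] v →
                   [ x < u ] + [ y < v ] ≡ [ y < u ] + [ x < v ]
descent-exchange {x} {y} {u} {v} u≼ˣv u≼ʸv = begin
  [ x < u ] + [ y < v ]             ≡⟨ cong (_+ [ y < v ]) (≼-indicator u≼ˣv) ⟩
  [ x < v ] + [ v < u ] + [ y < v ] ≡⟨ +-swap-outer [ x < v ] [ v < u ] [ y < v ] ⟩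
  [ y < v ] + [ v < u ] + [ x < v ] ≡⟨ cong (_+ [ x < v ]) (≼-indicator u≼ʸv) ⟨
  [ y < u ] + [ x < v ]             ∎
  where
  open ≡-Reasoning
  +-swap-outer : ∀ a b c → a + b + c ≡ c + b + a
  +-swap-outer = solve-∀

data InversionFree : List ℕ → List ℕ → Set where
  single : ∀ v → InversionFree [] (v ∷ [])
  column : ∀ {x as u bs} → All (u ≼[ x ]_) bs → InversionFree as bs →
           InversionFree (x ∷ as) (u ∷ bs)

descentCount : List ℕ → List ℕ → ℕ
descentCount (x ∷ as) (u ∷ bs) = [ x < u ] + descentCount as bs
descentCount _        _        = 0

InversionFree-length : ∀ {as bs} → InversionFree as bs → length bs ≡ suc (length as)
InversionFree-length (single _)   = refl
InversionFree-length (column _ t) = cong suc (InversionFree-length t)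

last-∷ : ∀ {as bs} → InversionFree as bs → ∀ u → last (u ∷ bs) ≡ last bs
last-∷ (single _)   _ = refl
last-∷ (column _ _) _ = refl

least-unique : ∀ {x u u′ bs bs′} → All (u ≼[ x ]_) bs → All (u′ ≼[ x ]_) bs′ →
               u ∷ bs ↭ u′ ∷ bs′ → u ≡ u′
least-unique u≼ u′≼ p with ∈-resp-↭ p (here refl) | ∈-resp-↭ (↭-sym p) (here refl)
... | here u≡u′ | _         = u≡u′
... | there _   | here u′≡u = sym u′≡u
... | there u∈  | there u′∈ = ≼-antisym (All.lookup u≼ u′∈) (All.lookup u′≼ u∈)

least-exists : ∀ x s ss → ∃₂ λ m rest → s ∷ ss ↭ m ∷ rest × All (m ≼[ x ]_) rest
least-exists x s [] = s , [] , ↭.refl , []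
least-exists x s (t ∷ ts) with m , rest , p , m≼ ← least-exists x t ts with ≼-total x s m
... | inj₁ s≼m = s , t ∷ ts , ↭.refl , All-resp-↭ (↭-sym p) (s≼m ∷ All.map (≼-trans s≼m) m≼)
... | inj₂ m≼s = m , s ∷ rest , ↭.trans (prep s p) (swap s m ↭.refl) , m≼s ∷ m≼

InversionFree-unique : ∀ {as bs bs′} → InversionFree as bs → InversionFree as bs′ →
                       bs ↭ bs′ → bs ≡ bs′
InversionFree-unique (single _) (single _) p = ↭-singleton-inv p
InversionFree-unique (column u≼ t) (column u′≼ t′) p with refl ← least-unique u≼ u′≼ p =
  cong (_ ∷_) (InversionFree-unique t t′ (drop-∷ p))

InversionFree-exists : ∀ as bs → length bs ≡ suc (length as) →
                       ∃ λ bs′ → InversionFree as bs′ × bs′ ↭ bs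
InversionFree-exists [] (v ∷ []) _ = v ∷ [] , single v , ↭.refl
InversionFree-exists (x ∷ as) (s ∷ ss) len
  with m , rest , p , m≼ ← least-exists x s ss
  with bs′ , t , q ← InversionFree-exists as rest (cong pred (trans (sym (↭-length p)) len))
  = m ∷ bs′ , column (All-resp-↭ (↭-sym q) m≼) t , ↭.trans (prep m q) (↭-sym p)

next-least-unique : ∀ {x y u v v′ cs cs′} →
  All (u ≼[ x ]_) (v ∷ cs) → All (v ≼[ y ]_) cs →
  All (u ≼[ y ]_) (v′ ∷ cs′) → All (v′ ≼[ x ]_) cs′ →
  v ∷ cs ↭ v′ ∷ cs′ → v ≡ v′
next-least-unique u≼ˣ v≼ʸ u≼ʸ v′≼ˣ p
  with ∈-resp-↭ p (here refl) | ∈-resp-↭ (↭-sym p) (here refl)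
... | here v≡v′ | _         = v≡v′
... | there _   | here v′≡v = sym v′≡v
... | there v∈  | there v′∈ =
  ≼-antisym (≼-rebase (All.lookup u≼ʸ (there v∈)) (All.lookup u≼ˣ (there v′∈)) (All.lookup v≼ʸ v′∈))
            (All.lookup v′≼ˣ v∈)

least-becomes-next : ∀ {x u v u′ v′ cs cs′} → u ≢ u′ →
  All (u ≼[ x ]_) (v ∷ cs) → All (v′ ≼[ x ]_) cs′ →
  u ∷ v ∷ cs ↭ u′ ∷ v′ ∷ cs′ → u ≡ v′
least-becomes-next u≢u′ u≼ v′≼ p with ∈-resp-↭ p (here refl)
... | here u≡u′         = ⊥-elim (u≢u′ u≡u′)
... | there (here u≡v′) = u≡v′
... | there (there u∈) with ∈-resp-↭ (↭-sym p) (there (here refl))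
...   | here v′≡u = sym v′≡u
...   | there v′∈ = ≼-antisym (All.lookup u≼ v′∈) (All.lookup v′≼ u∈)

swap-columns : ∀ {x y as as′ u v cs u′ v′ cs′} →
  InversionFree (x ∷ y ∷ as) (u ∷ v ∷ cs) → InversionFree (y ∷ x ∷ as′) (u′ ∷ v′ ∷ cs′) →
  u ∷ v ∷ cs ↭ u′ ∷ v′ ∷ cs′ →
  cs ↭ cs′ × [ x < u ] + [ y < v ] ≡ [ y < u′ ] + [ x < v′ ]
swap-columns {x} {y} {u = u} {v} {u′ = u′} (column u≼ (column v≼ _)) (column u′≼ (column v′≼ _)) p
  with u ≟ u′
... | yes refl with refl ← next-least-unique u≼ v≼ u′≼ v′≼ (drop-∷ p) =
  drop-∷ (drop-∷ p) , descent-exchange (All.head u≼) (All.head u′≼)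
... | no u≢u′ with refl ← least-becomes-next u≢u′ u≼ v′≼ p
                 | refl ← least-becomes-next (u≢u′ ∘ sym) u′≼ v≼ (↭-sym p) =
  drop-∷ (drop-∷ (↭.trans p (swap _ _ ↭.refl))) , +-comm [ x < u ] [ y < v ]

InversionFree-invariant : ∀ {as as′ bs bs′} → as ↭ as′ →
  InversionFree as bs → InversionFree as′ bs′ → bs ↭ bs′ →
  last bs ≡ last bs′ × descentCount as bs ≡ descentCount as′ bs′
InversionFree-invariant ↭.refl t t′ p with refl ← InversionFree-unique t t′ p = refl , refl
InversionFree-invariant (prep x q) (column {u = u} u≼ t) (column u′≼ t′) p
  with refl ← least-unique u≼ u′≼ p
  with last≡ , count≡ ← InversionFree-invariant q t t′ (drop-∷ p)
  = trans (last-∷ t u) (trans last≡ (sym (last-∷ t′ u))) , cong ([ x < u ] +_) count≡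
InversionFree-invariant (swap x y q)
  t@(column {u = u} _ (column {u = v} _ t₂)) t′@(column {u = u′} _ (column {u = v′} _ t′₂)) p
  with cs↭ , exchange ← swap-columns t t′ p
  with last≡ , count≡ ← InversionFree-invariant q t₂ t′₂ cs↭
  = trans (last-∷ t₂ v) (trans last≡ (sym (last-∷ t′₂ v′)))
  , trans (sym (+-assoc [ x < u ] [ y < v ] _))
          (trans (cong₂ _+_ exchange count≡) (+-assoc [ y < u′ ] [ x < v′ ] _))
InversionFree-invariant (↭.trans q₁ q₂) t t′ p
  with bs″ , t″ , p″ ← InversionFree-exists _ _ (trans (InversionFree-length t) (cong suc (↭-length q₁)))
  with last≡₁ , count≡₁ ← InversionFree-invariant q₁ t t″ (↭-sym p″)
  with last≡₂ , count≡₂ ← InversionFree-invariant q₂ t″ t′ (↭.trans p″ p)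
  = trans last≡₁ last≡₂ , trans count≡₁ count≡₂

NoInversions⇒InversionFree : ∀ n (a : Fin n → ℕ) (b : Fin (suc n) → ℕ) →
  NoInversions a b → InversionFree (tabulate a) (tabulate b)
NoInversions⇒InversionFree zero    a b _     = single (b zero)
NoInversions⇒InversionFree (suc n) a b noInv =
  column (tabulate⁺ λ j → ¬Inverted⇒≼ _ _ _ λ inv → noInv zero (suc j) (z<s , inv))
         (NoInversions⇒InversionFree n (a ∘ suc) (b ∘ suc)
            λ i j (i<j , inv) → noInv (suc i) (suc j) (s<s i<j , inv))

last-tabulate : ∀ n (f : Fin (suc n) → ℕ) → last (tabulate f) ≡ just (f (fromℕ n))
last-tabulate zero    f = refl
last-tabulate (suc n) f = last-tabulate n (f ∘ suc)

length-filter-tabulate : ∀ {A : Set} {k} (x u : A → ℕ) (c : Fin k → A) (b : Fin (suc k) → ℕ) →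
  (∀ i → b (inject₁ i) ≡ u (c i)) →
  length (filter (λ t → x t <? u t) (tabulate c)) ≡ descentCount (tabulate (x ∘ c)) (tabulate b)
length-filter-tabulate {k = zero}  x u c b _  = refl
length-filter-tabulate {k = suc k} x u c b b≡ rewrite b≡ zero with x (c zero) <ᵇ u (c zero)
... | true  = cong suc (length-filter-tabulate x u (c ∘ suc) (b ∘ suc) (b≡ ∘ suc))
... | false = length-filter-tabulate x u (c ∘ suc) (b ∘ suc) (b≡ ∘ suc)

descents-tabulate : ∀ n (a : Fin n → ℕ) (b : Fin (suc n) → ℕ) →
  descents a b ≡ descentCount (tabulate a) (tabulate b)
descents-tabulate n a b = length-filter-tabulate a (b ∘ inject₁) (λ i → i) b λ _ → refl

tabulate-rearr-↭ : ∀ {n} (f : Fin n → ℕ) (σ : Permutation′ n) → tabulate (rearr σ f) ↭ tabulate f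
tabulate-rearr-↭ f σ = begin
  tabulate (rearr σ f)                 ≡⟨ tabulate-as-sum (rearr σ f) ⟩
  ++-sum (λ i → rearr σ f i ∷ [])      ↭⟨ ↭-sym (++-sum-permute (λ i → f i ∷ []) σ) ⟩
  ++-sum (λ i → f i ∷ [])              ≡⟨ tabulate-as-sum f ⟨
  tabulate f                           ∎
  where
  open PermutationReasoning
  open CommutativeMonoidSum (++-commutativeMonoid {A = ℕ})
    using () renaming (sum to ++-sum; sum-permute to ++-sum-permute)
  tabulate-as-sum : ∀ {n} (g : Fin n → ℕ) → tabulate g ≡ ++-sum (λ i → g i ∷ [])
  tabulate-as-sum {zero}  g = refl
  tabulate-as-sum {suc n} g = cong (g zero ∷_) (tabulate-as-sum (g ∘ suc))

≼-argmin : ∀ x {n} (f : Fin (suc n) → ℕ) → ∃ λ k → ∀ j → f k ≼[ x ] f j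
≼-argmin x {zero}  f = zero , λ { zero → ≼-refl x (f zero) }
≼-argmin x {suc n} f with k , fk≼ ← ≼-argmin x (f ∘ suc) with ≼-total x (f zero) (f (suc k))
... | inj₁ f0≼fk = zero  , λ { zero → ≼-refl x (f zero) ; (suc j) → ≼-trans f0≼fk (fk≼ j) }
... | inj₂ fk≼f0 = suc k , λ { zero → fk≼f0 ; (suc j) → fk≼ j }

NoInversions-exists : ∀ n (a : Fin n → ℕ) (b : Fin (suc n) → ℕ) →
  ∃ λ (τ : Permutation′ (suc n)) → NoInversions a (rearr τ b)
NoInversions-exists zero    a b = id , λ ()
NoInversions-exists (suc n) a b
  with k , bk≼ ← ≼-argmin (a zero) b
  with τ , noInv ← NoInversions-exists n (a ∘ suc) (rearr (transpose zero k) b ∘ suc)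
  = lift₀ τ ∘ₚ transpose zero k , noInv′
  where
  noInv′ : NoInversions a (rearr (lift₀ τ ∘ₚ transpose zero k) b)
  noInv′ zero    (suc j) (_ , inv)       = ≼⇒¬Inverted (bk≼ _) inv
  noInv′ (suc i) (suc j) (s<s i<j , inv) = noInv i j (i<j , inv)

NoInversions-invariant : ∀ n (a : Fin n → ℕ) (b : Fin (suc n) → ℕ)
  (σ : Permutation′ n) (τ : Permutation′ (suc n)) →
  NoInversions a b → NoInversions (rearr σ a) (rearr τ b) →
  rearr τ b (fromℕ n) ≡ b (fromℕ n) × descents (rearr σ a) (rearr τ b) ≡ descents a b
NoInversions-invariant n a b σ τ noInv noInv′
  with last≡ , count≡ ← InversionFree-invariant (tabulate-rearr-↭ a σ)
                          (NoInversions⇒InversionFree n (rearr σ a) (rearr τ b) noInv′)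
                          (NoInversions⇒InversionFree n a b noInv)
                          (tabulate-rearr-↭ b τ)
  = just-injective (trans (sym (last-tabulate n (rearr τ b))) (trans last≡ (last-tabulate n b)))
  , trans (descents-tabulate n (rearr σ a) (rearr τ b)) (trans count≡ (sym (descents-tabulate n a b)))

-- Positivity of the entries is not needed.
mainTheorem15 : (n : ℕ) (a : Fin n → ℕ) (b : Fin (suc n) → ℕ) →
    Positive a → Positive b → NoInversions a b →
    (σ : Permutation′ n) →
    Σ (Permutation′ (suc n)) (λ τ → NoInversions (rearr σ a) (rearr τ b))
    × ((τ : Permutation′ (suc n)) → NoInversions (rearr σ a) (rearr τ b) →
        (rearr τ b (lastCol n) ≡ b (lastCol n))
        × (descents (rearr σ a) (rearr τ b) ≡ descents a b))
mainTheorem15 n a b _ _ noInv σ =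
  NoInversions-exists n (rearr σ a) b , λ τ → NoInversions-invariant n a b σ τ noInv
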